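{- Let $w=u_1\oplus\cdots\oplus u_k\in\mathrm{Tam}_n$, where $u_1,\dots,u_k$ are the components of $w$, and let $n_i$ be the size of $u_i$. Then $w\in\mathbf{E}(\mathrm{Tam}_n)$ if and only if $u_i\in\mathbf{E}(\mathrm{Tam}_{n_i})$ for all $1\le i\le k$.
   Context: $\mathrm{Tam}_n$ is the set of $312$-avoiding permutations of $[n]$ (no $i_1<i_2<i_3$ with $w(i_2)<w(i_3)<w(i_1)$), a sublattice of the right weak order on $S_n$ ($u\le v$ iff every inversion of $u$ is one of $v$). For $u\in S_m$, $v\in S_n$, the direct sum $u\oplus v\in S_{m+n}$ is given by $(u\oplus v)(i)=u(i)$ for $i\le m$ and $m+v(i-m)$ for $i>m$. A permutation is indecomposable if it is not a direct sum of two smaller permutations; every permutation is uniquely $u_1\oplus\cdots\oplus u_k$ with $u_i$ indecomposable, its components. Ungar moves in a lattice $L$ send $x$ to $\bigwedge(\{x\}\cup T)$ with $T$ a subset of the elements covered by $x$ (nontrivial if $T\ne\emptyset$); $\mathrm{Ung}(x)$ is the set of results. Recursively, the bottom element is an Eeta win and $x$ is an Atniss win iff some element of $\mathrm{Ung}(x)\setminus\{x\}$ is an Eeta win, otherwise an Eeta win; $\mathbf{E}(L)$ is the set of Eeta wins. -}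

module Defs where

open import Data.Nat using (ℕ; zero; suc; _+_) renaming (_<_ to _<ℕ_)
open import Data.Fin using (Fin; _<_; _↑ˡ_; _↑ʳ_)
open import Data.Vec using (Vec; []; _∷_; _++_; map; lookup)
open import Data.List using (List; []; _∷_)
open import Data.List.Relation.Unary.All using (All)
open import Data.Product using (Σ; _×_; _,_; ∃)
open import Data.Sum using (_⊎_)
open import Relation.Binary.PropositionalEquality using (_≡_; _≢_; subst)
open import Relation.Nullary using (¬_)

-- A permutation of [n] in one-line notation: w(i) = lookup w i (0-indexed).
Perm : ℕ → Set
Perm n = Vec (Fin n) n

IsPerm : ∀ {n} → Perm n → Set
IsPerm {n} w = ∀ (i j : Fin n) → lookup w i ≡ lookup w j → i ≡ j

Avoids312 : ∀ {n} → Perm n → Set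
Avoids312 {n} w = ¬ (Σ (Fin n) λ i₁ → Σ (Fin n) λ i₂ → Σ (Fin n) λ i₃ →
  i₁ < i₂ × i₂ < i₃ × lookup w i₂ < lookup w i₃ × lookup w i₃ < lookup w i₁)

Tam : ∀ {n} → Perm n → Set
Tam w = IsPerm w × Avoids312 w

Before : ∀ {n} → Fin n → Fin n → Perm n → Set
Before {n} b a w = Σ (Fin n) λ i → Σ (Fin n) λ j →
  i < j × lookup w i ≡ b × lookup w j ≡ a

IsInversion : ∀ {n} → Perm n → Fin n → Fin n → Set
IsInversion w a b = a < b × Before b a w

_≤W_ : ∀ {n} → Perm n → Perm n → Set
_≤W_ {n} u v = ∀ (a b : Fin n) → IsInversion u a b → IsInversion v a b

Covers : ∀ {n} → Perm n → Perm n → Set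
Covers {n} x y = Tam y × y ≤W x × y ≢ x ×
  (∀ (z : Perm n) → Tam z → y ≤W z → z ≤W x → z ≡ y ⊎ z ≡ x)

IsMeet : ∀ {n} → List (Perm n) → Perm n → Set
IsMeet {n} S y = Tam y × All (y ≤W_) S ×
  (∀ (z : Perm n) → Tam z → All (z ≤W_) S → z ≤W y)

Ung : ∀ {n} → Perm n → Perm n → Set
Ung {n} x y = Σ (List (Perm n)) λ T → All (Covers x) T × IsMeet (x ∷ T) y

-- The Ungar game on Tam_n: Eeta wins / Atniss wins (well-founded, since
-- nontrivial moves strictly decrease in the finite lattice).
data EetaWin {n : ℕ} (x : Perm n) : Set
data AtnissWin {n : ℕ} (x : Perm n) : Set

data EetaWin {n} x where
  eeta : (∀ (y : Perm n) → Ung x y → y ≢ x → AtnissWin y) → EetaWin x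

data AtnissWin {n} x where
  atniss : (y : Perm n) → Ung x y → y ≢ x → EetaWin y → AtnissWin x

_⊕_ : ∀ {m n} → Perm m → Perm n → Perm (m + n)
_⊕_ {m} {n} u v = map (_↑ˡ n) u ++ map (m ↑ʳ_) v

Indecomposable : ∀ {m} → Perm m → Set
Indecomposable {m} u = ∀ (a b : ℕ) (u₁ : Perm a) (u₂ : Perm b)
  (eq : a + b ≡ m) → 0 <ℕ a → 0 <ℕ b → IsPerm u₁ → IsPerm u₂ →
  ¬ (subst Perm eq (u₁ ⊕ u₂) ≡ u)

SizedPerm : Set
SizedPerm = Σ ℕ Perm

totalSize : List SizedPerm → ℕ
totalSize [] = 0
totalSize ((m , _) ∷ cs) = m + totalSize cs

bigSum : (cs : List SizedPerm) → Perm (totalSize cs)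
bigSum [] = []
bigSum ((m , u) ∷ cs) = u ⊕ bigSum cs

IsComponent : SizedPerm → Set
IsComponent (m , u) = 0 <ℕ m × IsPerm u × Indecomposable u

EetaWinSized : SizedPerm → Set
EetaWinSized (m , u) = EetaWin u

{-# OPTIONS --safe #-}
-- A permutation z below u ⊕ v in the weak order has no inversion across the two blocks,
-- so it is itself a sum z₁ ⊕ z₂ with z₁ ≤ u and z₂ ≤ v: the interval below u ⊕ v is the
-- product of the intervals below u and below v. Hence the elements covered by u ⊕ v are
-- the t ⊕ v and u ⊕ t with t covered by u, resp. v, meets are computed blockwise, and the
-- Ungar moves from u ⊕ v are exactly the u′ ⊕ v′ with u′ ∈ Ung(u), v′ ∈ Ung(v). If u and v
-- are Eeta wins, a nontrivial move turns some summands into Atniss wins, and combining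
-- their winning moves leads back to a sum of Eeta wins. Conversely, if u ⊕ v is an Eeta
-- win and u′ ∈ Ung(u) ∖ {u}, then u′ ⊕ v is an Atniss win, and its winning move cannot
-- leave u′ fixed (it would be a single move from u ⊕ v), so it yields one for u′.
module Submission where

open import Defs
open import Data.Empty using (⊥-elim)
open import Data.Fin using (Fin; zero; suc; _<_; _↑ˡ_; _↑ʳ_; toℕ; _≟_; punchOut)
open import Data.Fin.Induction using (<-wellFounded)
open import Data.Fin.Properties
  using (toℕ-↑ˡ; toℕ-↑ʳ; toℕ<n; ↑ˡ-injective; ↑ʳ-injective; <-cmp; any?; punchOut-injective; injective⇒≤)
open import Data.List as List using (List; []; _∷_; _++_)
open import Data.List.Relation.Unary.All as All using (All; []; _∷_)
open import Data.List.Relation.Unary.All.Properties using (++⁺; map⁺)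
open import Data.Nat as ℕ using (ℕ)
import Data.Nat.Properties as ℕ
open import Data.Product as Product using (∃; _×_; _,_; proj₁; proj₂)
open import Data.Sum as Sum using (_⊎_; inj₁; inj₂)
open import Data.Vec as Vec using (Vec; lookup; tabulate)
open import Data.Vec.Properties using (≡-dec; lookup-++ˡ; lookup-++ʳ; lookup-map; tabulate∘lookup; tabulate-cong; lookup∘tabulate)
open import Function.Base using (_∘_)
open import Function.Bundles using (_⇔_; mk⇔; Equivalence)
open Equivalence using (to; from)
import Induction.WellFounded as WF
open import Level using (0ℓ)
open import Relation.Binary.Definitions using (DecidableEquality; tri<; tri≈; tri>)
open import Relation.Binary.PropositionalEquality
open import Relation.Nullary using (¬_; yes; no)

private variable
  k m n : ℕ

data SplitView (m n : ℕ) : Fin (m ℕ.+ n) → Set where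
  inˡ : (i : Fin m) → SplitView m n (i ↑ˡ n)
  inʳ : (j : Fin n) → SplitView m n (m ↑ʳ j)

splitView : ∀ m n (k : Fin (m ℕ.+ n)) → SplitView m n k
splitView ℕ.zero    n k       = inʳ k
splitView (ℕ.suc m) n zero    = inˡ zero
splitView (ℕ.suc m) n (suc k) with splitView m n k
... | inˡ i = inˡ (suc i)
... | inʳ j = inʳ j

↑ˡ-mono-< : ∀ n {i j : Fin m} → i < j → i ↑ˡ n < j ↑ˡ n
↑ˡ-mono-< n {i} {j} = subst₂ ℕ._<_ (sym (toℕ-↑ˡ i n)) (sym (toℕ-↑ˡ j n))

↑ˡ-cancel-< : ∀ n {i j : Fin m} → i ↑ˡ n < j ↑ˡ n → i < j
↑ˡ-cancel-< n {i} {j} = subst₂ ℕ._<_ (toℕ-↑ˡ i n) (toℕ-↑ˡ j n)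

↑ʳ-mono-< : ∀ m {i j : Fin n} → i < j → m ↑ʳ i < m ↑ʳ j
↑ʳ-mono-< m {i} {j} i<j = subst₂ ℕ._<_ (sym (toℕ-↑ʳ m i)) (sym (toℕ-↑ʳ m j)) (ℕ.+-monoʳ-< m i<j)

↑ʳ-cancel-< : ∀ m {i j : Fin n} → m ↑ʳ i < m ↑ʳ j → i < j
↑ʳ-cancel-< m {i} {j} lt = ℕ.+-cancelˡ-< m _ _ (subst₂ ℕ._<_ (toℕ-↑ʳ m i) (toℕ-↑ʳ m j) lt)

↑ˡ<↑ʳ : (i : Fin m) (j : Fin n) → i ↑ˡ n < m ↑ʳ j
↑ˡ<↑ʳ {m} {n} i j = subst₂ ℕ._<_ (sym (toℕ-↑ˡ i n)) (sym (toℕ-↑ʳ m j))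
  (ℕ.<-≤-trans (toℕ<n i) (ℕ.m≤m+n m (toℕ j)))

↑ʳ≮↑ˡ : (i : Fin m) (j : Fin n) → ¬ (m ↑ʳ j < i ↑ˡ n)
↑ʳ≮↑ˡ i j lt = ℕ.<-asym lt (↑ˡ<↑ʳ i j)

↑ˡ≢↑ʳ : (i : Fin m) (j : Fin n) → i ↑ˡ n ≢ m ↑ʳ j
↑ˡ≢↑ʳ i j eq = ℕ.<-irrefl (cong toℕ eq) (↑ˡ<↑ʳ i j)

injective⇒surjective : (f : Fin k → Fin k) → (∀ i j → f i ≡ f j → i ≡ j) → ∀ y → ∃ λ x → f x ≡ y
injective⇒surjective {ℕ.zero}  f f-inj ()
injective⇒surjective {ℕ.suc k} f f-inj y with any? (λ x → f x ≟ y)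
... | yes found = found
... | no missed = ⊥-elim (ℕ.<-irrefl refl (injective⇒≤ g-inj))
  where
  f≢y : ∀ x → y ≢ f x
  f≢y x eq = missed (x , sym eq)
  -- f would inject Fin (suc k) into Fin (suc k) ∖ {y} ≅ Fin k
  g : Fin (ℕ.suc k) → Fin k
  g x = punchOut (f≢y x)
  g-inj : ∀ {x x′} → g x ≡ g x′ → x ≡ x′
  g-inj {x} {x′} eq = f-inj x x′ (punchOut-injective (f≢y x) (f≢y x′) eq)

lookup-ext : ∀ {A : Set} (w w′ : Vec A k) → (∀ i → lookup w i ≡ lookup w′ i) → w ≡ w′
lookup-ext w w′ eq = trans (sym (tabulate∘lookup w)) (trans (tabulate-cong eq) (tabulate∘lookup w′))

≤W-refl : (w : Perm k) → w ≤W w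
≤W-refl _ _ _ inv = inv

before-asym : {w : Perm k} {b c : Fin k} → IsPerm w → Before b c w → ¬ Before c b w
before-asym w-perm (i , j , i<j , i↦b , j↦c) (i′ , j′ , i′<j′ , i′↦c , j′↦b)
  with w-perm i j′ (trans i↦b (sym j′↦b)) | w-perm j i′ (trans j↦c (sym i′↦c))
... | refl | refl = ℕ.<-asym i<j i′<j′

module _ (w w′ : Perm k) (w-perm : IsPerm w) (w′-perm : IsPerm w′)
         (w≤w′ : w ≤W w′) (w′≤w : w′ ≤W w) where

  private
    before-≤W : ∀ {b c} → b ≢ c → Before b c w → Before b c w′
    before-≤W {b} {c} b≢c b→c with <-cmp b c
    ... | tri> _ _ c<b = proj₂ (w≤w′ c b (c<b , b→c))
    ... | tri≈ _ b≡c _ = ⊥-elim (b≢c b≡c)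
    ... | tri< b<c _ _
      with injective⇒surjective (lookup w′) w′-perm b | injective⇒surjective (lookup w′) w′-perm c
    ...   | p , p↦b | q , q↦c with <-cmp p q
    ...     | tri< p<q _ _ = p , q , p<q , p↦b , q↦c
    ...     | tri≈ _ refl _ = ⊥-elim (b≢c (trans (sym p↦b) q↦c))
    ...     | tri> _ _ q<p = ⊥-elim (before-asym {w = w} w-perm b→c (proj₂ (w′≤w b c (b<c , q , p , q<p , q↦c , p↦b))))

    -- if w and w′ first differed at i, the value w′ i would sit after i in w,
    -- and then the value w i would have to sit before i in w′, contradicting the prefix
    agree-from-prefix : ∀ i → (∀ {j} → j < i → lookup w j ≡ lookup w′ j) → lookup w i ≡ lookup w′ i
    agree-from-prefix i prefix with lookup w i ≟ lookup w′ i
    ... | yes eq = eq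
    ... | no w≢w′ with injective⇒surjective (lookup w) w-perm (lookup w′ i)
    ...   | k , k↦ with <-cmp i k
    ...     | tri≈ _ refl _ = ⊥-elim (w≢w′ k↦)
    ...     | tri> _ _ k<i = ⊥-elim (ℕ.<-irrefl (cong toℕ (w′-perm k i (trans (sym (prefix k<i)) k↦))) k<i)
    ...     | tri< i<k _ _ with before-≤W w≢w′ (i , k , i<k , refl , k↦)
    ...       | p , q , p<q , p↦ , q↦ with w′-perm q i q↦
    ...         | refl = ⊥-elim (ℕ.<-irrefl (cong toℕ (w-perm p i (trans (prefix p<q) p↦))) p<q)

  ≤W-antisym : w ≡ w′
  ≤W-antisym = lookup-ext w w′ (WF.All.wfRec <-wellFounded 0ℓ _ agree-from-prefix)

_≟ₚ_ : DecidableEquality (Perm k)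
_≟ₚ_ = ≡-dec _≟_

ung-refl : (w : Perm k) → Tam w → Ung w w
ung-refl w w-tam = [] , [] , w-tam , ≤W-refl w ∷ [] , λ { _ _ (z≤w ∷ []) → z≤w }

ung-tam : {w : Perm k} (y : Perm k) → Ung w y → Tam y
ung-tam _ (_ , _ , y-tam , _) = y-tam

eetaWin⇒¬atnissWin : {w : Perm k} → EetaWin w → ¬ AtnissWin w
eetaWin⇒¬atnissWin (eeta atnissAfter) (atniss y move y≢w y-eeta) =
  eetaWin⇒¬atnissWin y-eeta (atnissAfter y move y≢w)

module _ {m n : ℕ} where

  module _ (u : Perm m) (v : Perm n) where

    lookup-⊕ˡ : ∀ i → lookup (u ⊕ v) (i ↑ˡ n) ≡ lookup u i ↑ˡ n
    lookup-⊕ˡ i = trans (lookup-++ˡ (Vec.map (_↑ˡ n) u) (Vec.map (m ↑ʳ_) v) i) (lookup-map i (_↑ˡ n) u)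

    lookup-⊕ʳ : ∀ j → lookup (u ⊕ v) (m ↑ʳ j) ≡ m ↑ʳ lookup v j
    lookup-⊕ʳ j = trans (lookup-++ʳ (Vec.map (_↑ˡ n) u) (Vec.map (m ↑ʳ_) v) j) (lookup-map j (m ↑ʳ_) v)

    position-⊕ˡ : ∀ p x → lookup (u ⊕ v) p ≡ x ↑ˡ n → ∃ λ i → p ≡ i ↑ˡ n × lookup u i ≡ x
    position-⊕ˡ p x eq with splitView m n p
    ... | inˡ i = i , refl , ↑ˡ-injective n _ _ (trans (sym (lookup-⊕ˡ i)) eq)
    ... | inʳ j = ⊥-elim (↑ˡ≢↑ʳ x (lookup v j) (trans (sym eq) (lookup-⊕ʳ j)))

    position-⊕ʳ : ∀ p y → lookup (u ⊕ v) p ≡ m ↑ʳ y → ∃ λ j → p ≡ m ↑ʳ j × lookup v j ≡ y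
    position-⊕ʳ p y eq with splitView m n p
    ... | inˡ i = ⊥-elim (↑ˡ≢↑ʳ (lookup u i) y (trans (sym (lookup-⊕ˡ i)) eq))
    ... | inʳ j = j , refl , ↑ʳ-injective m _ _ (trans (sym (lookup-⊕ʳ j)) eq)

  ⊕-injectiveˡ : {u u′ : Perm m} {v v′ : Perm n} → u ⊕ v ≡ u′ ⊕ v′ → u ≡ u′
  ⊕-injectiveˡ {u} {u′} {v} {v′} eq = lookup-ext u u′ λ i → ↑ˡ-injective n _ _ (begin
    lookup u i ↑ˡ n            ≡⟨ lookup-⊕ˡ u v i ⟨
    lookup (u ⊕ v) (i ↑ˡ n)    ≡⟨ cong (λ w → lookup w (i ↑ˡ n)) eq ⟩
    lookup (u′ ⊕ v′) (i ↑ˡ n)  ≡⟨ lookup-⊕ˡ u′ v′ i ⟩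
    lookup u′ i ↑ˡ n           ∎)
    where open ≡-Reasoning

  ⊕-injectiveʳ : {u u′ : Perm m} {v v′ : Perm n} → u ⊕ v ≡ u′ ⊕ v′ → v ≡ v′
  ⊕-injectiveʳ {u} {u′} {v} {v′} eq = lookup-ext v v′ λ j → ↑ʳ-injective m _ _ (begin
    m ↑ʳ lookup v j            ≡⟨ lookup-⊕ʳ u v j ⟨
    lookup (u ⊕ v) (m ↑ʳ j)    ≡⟨ cong (λ w → lookup w (m ↑ʳ j)) eq ⟩
    lookup (u′ ⊕ v′) (m ↑ʳ j)  ≡⟨ lookup-⊕ʳ u′ v′ j ⟩
    m ↑ʳ lookup v′ j           ∎)
    where open ≡-Reasoning

  module _ (u : Perm m) (v : Perm n) where

    inversion-⊕ˡ⁺ : ∀ {x y} → IsInversion u x y → IsInversion (u ⊕ v) (x ↑ˡ n) (y ↑ˡ n)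
    inversion-⊕ˡ⁺ (x<y , i , j , i<j , refl , refl) =
      ↑ˡ-mono-< n x<y , i ↑ˡ n , j ↑ˡ n , ↑ˡ-mono-< n i<j , lookup-⊕ˡ u v i , lookup-⊕ˡ u v j

    inversion-⊕ʳ⁺ : ∀ {x y} → IsInversion v x y → IsInversion (u ⊕ v) (m ↑ʳ x) (m ↑ʳ y)
    inversion-⊕ʳ⁺ (x<y , i , j , i<j , refl , refl) =
      ↑ʳ-mono-< m x<y , m ↑ʳ i , m ↑ʳ j , ↑ʳ-mono-< m i<j , lookup-⊕ʳ u v i , lookup-⊕ʳ u v j

    inversion-⊕ˡ⁻ : ∀ {x y} → IsInversion (u ⊕ v) (x ↑ˡ n) (y ↑ˡ n) → IsInversion u x y
    inversion-⊕ˡ⁻ {x} {y} (x<y , p , q , p<q , p↦y , q↦x)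
      with position-⊕ˡ u v p y p↦y | position-⊕ˡ u v q x q↦x
    ... | i , refl , i↦y | j , refl , j↦x = ↑ˡ-cancel-< n x<y , i , j , ↑ˡ-cancel-< n p<q , i↦y , j↦x

    inversion-⊕ʳ⁻ : ∀ {x y} → IsInversion (u ⊕ v) (m ↑ʳ x) (m ↑ʳ y) → IsInversion v x y
    inversion-⊕ʳ⁻ {x} {y} (x<y , p , q , p<q , p↦y , q↦x)
      with position-⊕ʳ u v p y p↦y | position-⊕ʳ u v q x q↦x
    ... | i , refl , i↦y | j , refl , j↦x = ↑ʳ-cancel-< m x<y , i , j , ↑ʳ-cancel-< m p<q , i↦y , j↦x

    ⊕-noCrossInversion : ∀ x y → ¬ IsInversion (u ⊕ v) (x ↑ˡ n) (m ↑ʳ y)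
    ⊕-noCrossInversion x y (_ , p , q , p<q , p↦y , q↦x)
      with position-⊕ʳ u v p y p↦y | position-⊕ˡ u v q x q↦x
    ... | i , refl , _ | j , refl , _ = ↑ʳ≮↑ˡ j i p<q

  module _ (u : Perm m) (v : Perm n) (u′ : Perm m) (v′ : Perm n) where

    ≤W-⊕ : u ≤W u′ → v ≤W v′ → (u ⊕ v) ≤W (u′ ⊕ v′)
    ≤W-⊕ u≤u′ v≤v′ x y inv with splitView m n x | splitView m n y
    ... | inˡ i | inˡ j = inversion-⊕ˡ⁺ u′ v′ (u≤u′ i j (inversion-⊕ˡ⁻ u v inv))
    ... | inˡ i | inʳ j = ⊥-elim (⊕-noCrossInversion u v i j inv)
    ... | inʳ i | inˡ j = ⊥-elim (↑ʳ≮↑ˡ j i (proj₁ inv))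
    ... | inʳ i | inʳ j = inversion-⊕ʳ⁺ u′ v′ (v≤v′ i j (inversion-⊕ʳ⁻ u v inv))

    ≤W-⊕ˡ⁻ : (u ⊕ v) ≤W (u′ ⊕ v′) → u ≤W u′
    ≤W-⊕ˡ⁻ le x y inv = inversion-⊕ˡ⁻ u′ v′ (le _ _ (inversion-⊕ˡ⁺ u v inv))

    ≤W-⊕ʳ⁻ : (u ⊕ v) ≤W (u′ ⊕ v′) → v ≤W v′
    ≤W-⊕ʳ⁻ le x y inv = inversion-⊕ʳ⁻ u′ v′ (le _ _ (inversion-⊕ʳ⁺ u v inv))

  module _ (u : Perm m) (v : Perm n) where

    isPerm-⊕ : IsPerm u → IsPerm v → IsPerm (u ⊕ v)
    isPerm-⊕ u-perm v-perm p q eq with splitView m n p | splitView m n q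
    ... | inˡ i | inˡ j = cong (_↑ˡ n) (u-perm i j (↑ˡ-injective n _ _
      (trans (sym (lookup-⊕ˡ u v i)) (trans eq (lookup-⊕ˡ u v j)))))
    ... | inˡ i | inʳ j = ⊥-elim (↑ˡ≢↑ʳ _ _ (trans (sym (lookup-⊕ˡ u v i)) (trans eq (lookup-⊕ʳ u v j))))
    ... | inʳ i | inˡ j = ⊥-elim (↑ˡ≢↑ʳ _ _ (trans (sym (lookup-⊕ˡ u v j)) (trans (sym eq) (lookup-⊕ʳ u v i))))
    ... | inʳ i | inʳ j = cong (m ↑ʳ_) (v-perm i j (↑ʳ-injective m _ _
      (trans (sym (lookup-⊕ʳ u v i)) (trans eq (lookup-⊕ʳ u v j)))))

    isPerm-⊕ˡ⁻ : IsPerm (u ⊕ v) → IsPerm u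
    isPerm-⊕ˡ⁻ perm i j eq = ↑ˡ-injective n _ _
      (perm _ _ (trans (lookup-⊕ˡ u v i) (trans (cong (_↑ˡ n) eq) (sym (lookup-⊕ˡ u v j)))))

    isPerm-⊕ʳ⁻ : IsPerm (u ⊕ v) → IsPerm v
    isPerm-⊕ʳ⁻ perm i j eq = ↑ʳ-injective m _ _
      (perm _ _ (trans (lookup-⊕ʳ u v i) (trans (cong (m ↑ʳ_) eq) (sym (lookup-⊕ʳ u v j)))))

    avoids312-⊕ : Avoids312 u → Avoids312 v → Avoids312 (u ⊕ v)
    avoids312-⊕ u-avoids v-avoids (p₁ , p₂ , p₃ , p₁<p₂ , p₂<p₃ , w₂<w₃ , w₃<w₁)
      with splitView m n p₁ | splitView m n p₂ | splitView m n p₃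
    ... | inˡ i₁ | inˡ i₂ | inˡ i₃ = u-avoids (i₁ , i₂ , i₃ , ↑ˡ-cancel-< n p₁<p₂ , ↑ˡ-cancel-< n p₂<p₃ ,
      ↑ˡ-cancel-< n (subst₂ _<_ (lookup-⊕ˡ u v i₂) (lookup-⊕ˡ u v i₃) w₂<w₃) ,
      ↑ˡ-cancel-< n (subst₂ _<_ (lookup-⊕ˡ u v i₃) (lookup-⊕ˡ u v i₁) w₃<w₁))
    ... | inʳ j₁ | inʳ j₂ | inʳ j₃ = v-avoids (j₁ , j₂ , j₃ , ↑ʳ-cancel-< m p₁<p₂ , ↑ʳ-cancel-< m p₂<p₃ ,
      ↑ʳ-cancel-< m (subst₂ _<_ (lookup-⊕ʳ u v j₂) (lookup-⊕ʳ u v j₃) w₂<w₃) ,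
      ↑ʳ-cancel-< m (subst₂ _<_ (lookup-⊕ʳ u v j₃) (lookup-⊕ʳ u v j₁) w₃<w₁))
    ... | _      | inʳ j₂ | inˡ i₃ = ↑ʳ≮↑ˡ i₃ j₂ p₂<p₃
    ... | inʳ j₁ | inˡ i₂ | _      = ↑ʳ≮↑ˡ i₂ j₁ p₁<p₂
    ... | inˡ i₁ | _      | inʳ j₃ = ↑ʳ≮↑ˡ _ _ (subst₂ _<_ (lookup-⊕ʳ u v j₃) (lookup-⊕ˡ u v i₁) w₃<w₁)

    avoids312-⊕ˡ⁻ : Avoids312 (u ⊕ v) → Avoids312 u
    avoids312-⊕ˡ⁻ avoids (i₁ , i₂ , i₃ , i₁<i₂ , i₂<i₃ , w₂<w₃ , w₃<w₁) =
      avoids (i₁ ↑ˡ n , i₂ ↑ˡ n , i₃ ↑ˡ n , ↑ˡ-mono-< n i₁<i₂ , ↑ˡ-mono-< n i₂<i₃ ,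
        subst₂ _<_ (sym (lookup-⊕ˡ u v i₂)) (sym (lookup-⊕ˡ u v i₃)) (↑ˡ-mono-< n w₂<w₃) ,
        subst₂ _<_ (sym (lookup-⊕ˡ u v i₃)) (sym (lookup-⊕ˡ u v i₁)) (↑ˡ-mono-< n w₃<w₁))

    avoids312-⊕ʳ⁻ : Avoids312 (u ⊕ v) → Avoids312 v
    avoids312-⊕ʳ⁻ avoids (j₁ , j₂ , j₃ , j₁<j₂ , j₂<j₃ , w₂<w₃ , w₃<w₁) =
      avoids (m ↑ʳ j₁ , m ↑ʳ j₂ , m ↑ʳ j₃ , ↑ʳ-mono-< m j₁<j₂ , ↑ʳ-mono-< m j₂<j₃ ,
        subst₂ _<_ (sym (lookup-⊕ʳ u v j₂)) (sym (lookup-⊕ʳ u v j₃)) (↑ʳ-mono-< m w₂<w₃) ,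
        subst₂ _<_ (sym (lookup-⊕ʳ u v j₃)) (sym (lookup-⊕ʳ u v j₁)) (↑ʳ-mono-< m w₃<w₁))

    tam-⊕ : Tam u → Tam v → Tam (u ⊕ v)
    tam-⊕ (u-perm , u-avoids) (v-perm , v-avoids) = isPerm-⊕ u-perm v-perm , avoids312-⊕ u-avoids v-avoids

    tam-⊕ˡ⁻ : Tam (u ⊕ v) → Tam u
    tam-⊕ˡ⁻ (perm , avoids) = isPerm-⊕ˡ⁻ perm , avoids312-⊕ˡ⁻ avoids

    tam-⊕ʳ⁻ : Tam (u ⊕ v) → Tam v
    tam-⊕ʳ⁻ (perm , avoids) = isPerm-⊕ʳ⁻ perm , avoids312-⊕ʳ⁻ avoids

  module _ (z : Perm (m ℕ.+ n)) (z-perm : IsPerm z)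
           (noCross : ∀ x y → ¬ IsInversion z (x ↑ˡ n) (m ↑ʳ y)) where

    private
      LeftAt : Fin m → Fin m → Set
      LeftAt q x = lookup z (q ↑ˡ n) ≡ x ↑ˡ n

      surjective⇒total : (∀ x → ∃ λ q → LeftAt q x) → ∀ q → ∃ (LeftAt q)
      surjective⇒total at q with injective⇒surjective (proj₁ ∘ at) position-injective q
        where
        position-injective : ∀ x x′ → proj₁ (at x) ≡ proj₁ (at x′) → x ≡ x′
        position-injective x x′ eq = ↑ˡ-injective n _ _
          (trans (sym (proj₂ (at x))) (trans (cong (λ p → lookup z (p ↑ˡ n)) eq) (proj₂ (at x′))))
      ... | x , refl = x , proj₂ (at x)

      total⇒surjective : (∀ q → ∃ (LeftAt q)) → ∀ x → ∃ λ q → LeftAt q x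
      total⇒surjective at x with injective⇒surjective (proj₁ ∘ at) value-injective x
        where
        value-injective : ∀ q q′ → proj₁ (at q) ≡ proj₁ (at q′) → q ≡ q′
        value-injective q q′ eq = ↑ˡ-injective n _ _ (z-perm _ _
          (trans (proj₂ (at q)) (trans (cong (_↑ˡ n) eq) (sym (proj₂ (at q′))))))
      ... | q , refl = q , proj₂ (at q)

      valueˡ : ∀ i → ∃ (LeftAt i)
      valueˡ i with lookup z (i ↑ˡ n) in i↦
      ... | k with splitView m n k
      ...   | inˡ x = x , refl
      ...   | inʳ y = ⊥-elim (↑ˡ≢↑ʳ _ y (trans (sym (proj₂ (surjective⇒total leftAtLeft i))) i↦))
        where
        -- a left value at a right position would form an inversion with the right value at i
        leftAtLeft : ∀ x → ∃ λ q → LeftAt q x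
        leftAtLeft x with injective⇒surjective (lookup z) z-perm (x ↑ˡ n)
        ... | p , p↦x with splitView m n p
        ...   | inˡ q = q , p↦x
        ...   | inʳ j = ⊥-elim (noCross x y (↑ˡ<↑ʳ x y , i ↑ˡ n , m ↑ʳ j , ↑ˡ<↑ʳ i j , i↦ , p↦x))

      valueʳ : ∀ j → ∃ λ y → lookup z (m ↑ʳ j) ≡ m ↑ʳ y
      valueʳ j with lookup z (m ↑ʳ j) in j↦
      ... | k with splitView m n k
      ...   | inʳ y = y , refl
      ...   | inˡ x with total⇒surjective valueˡ x
      ...     | q , q↦x = ⊥-elim (↑ˡ≢↑ʳ q j (z-perm _ _ (trans q↦x (sym j↦))))

    split-⊕ : ∃ λ z₁ → ∃ λ z₂ → z ≡ z₁ ⊕ z₂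
    split-⊕ = z₁ , z₂ , lookup-ext z (z₁ ⊕ z₂) (λ p → lookup-split p (splitView m n p))
      where
      z₁ : Perm m
      z₁ = tabulate (proj₁ ∘ valueˡ)
      z₂ : Perm n
      z₂ = tabulate (proj₁ ∘ valueʳ)
      lookup-split : ∀ p → SplitView m n p → lookup z p ≡ lookup (z₁ ⊕ z₂) p
      lookup-split _ (inˡ i) = trans (proj₂ (valueˡ i))
        (sym (trans (lookup-⊕ˡ z₁ z₂ i) (cong (_↑ˡ n) (lookup∘tabulate _ i))))
      lookup-split _ (inʳ j) = trans (proj₂ (valueʳ j))
        (sym (trans (lookup-⊕ʳ z₁ z₂ j) (cong (m ↑ʳ_) (lookup∘tabulate _ j))))

  below-⊕ : (u : Perm m) (v : Perm n) (z : Perm (m ℕ.+ n)) → IsPerm z → z ≤W (u ⊕ v) →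
    ∃ λ z₁ → ∃ λ z₂ → z ≡ z₁ ⊕ z₂
  below-⊕ u v z z-perm z≤u⊕v =
    split-⊕ z z-perm (λ x y inv → ⊕-noCrossInversion u v x y (z≤u⊕v _ _ inv))

  -- Covers and Ungar moves in a direct sum

  module _ (u : Perm m) (v : Perm n) where

    covers-⊕ˡ : ∀ {t} → Tam v → Covers u t → Covers (u ⊕ v) (t ⊕ v)
    covers-⊕ˡ {t} v-tam (t-tam , t≤u , t≢u , between) =
      tam-⊕ t v t-tam v-tam , ≤W-⊕ t v u v t≤u (≤W-refl v) , t≢u ∘ ⊕-injectiveˡ , between-⊕
      where
      between-⊕ : ∀ z → Tam z → (t ⊕ v) ≤W z → z ≤W (u ⊕ v) → z ≡ t ⊕ v ⊎ z ≡ u ⊕ v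
      between-⊕ z z-tam t⊕v≤z z≤u⊕v with below-⊕ u v z (proj₁ z-tam) z≤u⊕v
      ... | z₁ , z₂ , refl
        with ≤W-antisym z₂ v (proj₁ (tam-⊕ʳ⁻ z₁ z₂ z-tam)) (proj₁ v-tam) (≤W-⊕ʳ⁻ z₁ z₂ u v z≤u⊕v) (≤W-⊕ʳ⁻ t v z₁ z₂ t⊕v≤z)
      ...   | refl = Sum.map (cong (_⊕ v)) (cong (_⊕ v))
        (between z₁ (tam-⊕ˡ⁻ z₁ v z-tam) (≤W-⊕ˡ⁻ t v z₁ v t⊕v≤z) (≤W-⊕ˡ⁻ z₁ v u v z≤u⊕v))

    covers-⊕ʳ : ∀ {t} → Tam u → Covers v t → Covers (u ⊕ v) (u ⊕ t)
    covers-⊕ʳ {t} u-tam (t-tam , t≤v , t≢v , between) =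
      tam-⊕ u t u-tam t-tam , ≤W-⊕ u t u v (≤W-refl u) t≤v , t≢v ∘ ⊕-injectiveʳ , between-⊕
      where
      between-⊕ : ∀ z → Tam z → (u ⊕ t) ≤W z → z ≤W (u ⊕ v) → z ≡ u ⊕ t ⊎ z ≡ u ⊕ v
      between-⊕ z z-tam u⊕t≤z z≤u⊕v with below-⊕ u v z (proj₁ z-tam) z≤u⊕v
      ... | z₁ , z₂ , refl
        with ≤W-antisym z₁ u (proj₁ (tam-⊕ˡ⁻ z₁ z₂ z-tam)) (proj₁ u-tam) (≤W-⊕ˡ⁻ z₁ z₂ u v z≤u⊕v) (≤W-⊕ˡ⁻ u t z₁ z₂ u⊕t≤z)
      ...   | refl = Sum.map (cong (u ⊕_)) (cong (u ⊕_))
        (between z₂ (tam-⊕ʳ⁻ u z₂ z-tam) (≤W-⊕ʳ⁻ u t u z₂ u⊕t≤z) (≤W-⊕ʳ⁻ u z₂ u v z≤u⊕v))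

    covers-⊕ˡ⁻ : ∀ {t} → Tam v → Covers (u ⊕ v) (t ⊕ v) → Covers u t
    covers-⊕ˡ⁻ {t} v-tam (t⊕v-tam , t⊕v≤u⊕v , t⊕v≢u⊕v , between) =
      tam-⊕ˡ⁻ t v t⊕v-tam , ≤W-⊕ˡ⁻ t v u v t⊕v≤u⊕v , t⊕v≢u⊕v ∘ cong (_⊕ v) ,
      λ z z-tam t≤z z≤u → Sum.map ⊕-injectiveˡ ⊕-injectiveˡ (between (z ⊕ v) (tam-⊕ z v z-tam v-tam)
        (≤W-⊕ t v z v t≤z (≤W-refl v)) (≤W-⊕ z v u v z≤u (≤W-refl v)))

    covers-⊕ʳ⁻ : ∀ {t} → Tam u → Covers (u ⊕ v) (u ⊕ t) → Covers v t
    covers-⊕ʳ⁻ {t} u-tam (u⊕t-tam , u⊕t≤u⊕v , u⊕t≢u⊕v , between) =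
      tam-⊕ʳ⁻ u t u⊕t-tam , ≤W-⊕ʳ⁻ u t u v u⊕t≤u⊕v , u⊕t≢u⊕v ∘ cong (u ⊕_) ,
      λ z z-tam t≤z z≤v → Sum.map ⊕-injectiveʳ ⊕-injectiveʳ (between (u ⊕ z) (tam-⊕ u z u-tam z-tam)
        (≤W-⊕ u t u z (≤W-refl u) t≤z) (≤W-⊕ u z u v (≤W-refl u) z≤v))

    covers-⊕⁻ : ∀ {t} → Tam u → Tam v → Covers (u ⊕ v) t →
      (∃ λ t₁ → t ≡ t₁ ⊕ v × Covers u t₁) ⊎ (∃ λ t₂ → t ≡ u ⊕ t₂ × Covers v t₂)
    covers-⊕⁻ {t} u-tam v-tam cover@(t-tam , t≤u⊕v , _ , between) with below-⊕ u v t (proj₁ t-tam) t≤u⊕v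
    ... | t₁ , t₂ , refl with t₂ ≟ₚ v
    ...   | yes refl = inj₁ (t₁ , refl , covers-⊕ˡ⁻ v-tam cover)
    ...   | no t₂≢v with between (t₁ ⊕ v) (tam-⊕ t₁ v (tam-⊕ˡ⁻ t₁ t₂ t-tam) v-tam)
                           (≤W-⊕ t₁ t₂ t₁ v (≤W-refl t₁) (≤W-⊕ʳ⁻ t₁ t₂ u v t≤u⊕v))
                           (≤W-⊕ t₁ v u v (≤W-⊕ˡ⁻ t₁ t₂ u v t≤u⊕v) (≤W-refl v))
    ...     | inj₁ t₁⊕v≡t = ⊥-elim (t₂≢v (sym (⊕-injectiveʳ t₁⊕v≡t)))
    ...     | inj₂ t₁⊕v≡u⊕v with ⊕-injectiveˡ {u = t₁} {u} t₁⊕v≡u⊕v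
    ...       | refl = inj₂ (t₂ , refl , covers-⊕ʳ⁻ u-tam cover)

    record LowerBoundsSplit (T : List (Perm (m ℕ.+ n))) (T₁ : List (Perm m)) (T₂ : List (Perm n)) : Set where
      field
        lowerBounds : ∀ z₁ z₂ → z₁ ≤W u → z₂ ≤W v →
          All ((z₁ ⊕ z₂) ≤W_) T ⇔ (All (z₁ ≤W_) T₁ × All (z₂ ≤W_) T₂)

    open LowerBoundsSplit

    lowerBoundsSplit-[] : LowerBoundsSplit [] [] []
    lowerBounds lowerBoundsSplit-[] _ _ _ _ = mk⇔ (λ _ → [] , []) (λ _ → [])

    lowerBoundsSplit-∷ˡ : ∀ {T T₁ T₂} t → LowerBoundsSplit T T₁ T₂ → LowerBoundsSplit (t ⊕ v ∷ T) (t ∷ T₁) T₂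
    lowerBounds (lowerBoundsSplit-∷ˡ t split) z₁ z₂ z₁≤u z₂≤v = mk⇔
      (λ { (z≤t⊕v ∷ z≤T) → Product.map₁ (≤W-⊕ˡ⁻ z₁ z₂ t v z≤t⊕v ∷_) (to (lowerBounds split z₁ z₂ z₁≤u z₂≤v) z≤T) })
      (λ { (z₁≤t ∷ z₁≤T₁ , z₂≤T₂) → ≤W-⊕ z₁ z₂ t v z₁≤t z₂≤v ∷ from (lowerBounds split z₁ z₂ z₁≤u z₂≤v) (z₁≤T₁ , z₂≤T₂) })

    lowerBoundsSplit-∷ʳ : ∀ {T T₁ T₂} t → LowerBoundsSplit T T₁ T₂ → LowerBoundsSplit (u ⊕ t ∷ T) T₁ (t ∷ T₂)
    lowerBounds (lowerBoundsSplit-∷ʳ t split) z₁ z₂ z₁≤u z₂≤v = mk⇔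
      (λ { (z≤u⊕t ∷ z≤T) → Product.map₂ (≤W-⊕ʳ⁻ z₁ z₂ u t z≤u⊕t ∷_) (to (lowerBounds split z₁ z₂ z₁≤u z₂≤v) z≤T) })
      (λ { (z₁≤T₁ , z₂≤t ∷ z₂≤T₂) → ≤W-⊕ z₁ z₂ u t z₁≤u z₂≤t ∷ from (lowerBounds split z₁ z₂ z₁≤u z₂≤v) (z₁≤T₁ , z₂≤T₂) })

    lowerBoundsSplit-++ : ∀ T₁ T₂ → LowerBoundsSplit (List.map (_⊕ v) T₁ ++ List.map (u ⊕_) T₂) T₁ T₂
    lowerBoundsSplit-++ (t ∷ T₁) T₂ = lowerBoundsSplit-∷ˡ t (lowerBoundsSplit-++ T₁ T₂)
    lowerBoundsSplit-++ [] (t ∷ T₂) = lowerBoundsSplit-∷ʳ t (lowerBoundsSplit-++ [] T₂)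
    lowerBoundsSplit-++ [] []       = lowerBoundsSplit-[]

    lowerBoundsSplit-covers : Tam u → Tam v → ∀ {T} → All (Covers (u ⊕ v)) T →
      ∃ λ T₁ → ∃ λ T₂ → All (Covers u) T₁ × All (Covers v) T₂ × LowerBoundsSplit T T₁ T₂
    lowerBoundsSplit-covers u-tam v-tam [] = [] , [] , [] , [] , lowerBoundsSplit-[]
    lowerBoundsSplit-covers u-tam v-tam (cover ∷ covers)
      with lowerBoundsSplit-covers u-tam v-tam covers | covers-⊕⁻ u-tam v-tam cover
    ... | T₁ , T₂ , covers₁ , covers₂ , split | inj₁ (t , refl , cover₁) =
      t ∷ T₁ , T₂ , cover₁ ∷ covers₁ , covers₂ , lowerBoundsSplit-∷ˡ t split
    ... | T₁ , T₂ , covers₁ , covers₂ , split | inj₂ (t , refl , cover₂) =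
      T₁ , t ∷ T₂ , covers₁ , cover₂ ∷ covers₂ , lowerBoundsSplit-∷ʳ t split

    isMeet-⊕ : ∀ {T T₁ T₂} (y₁ : Perm m) (y₂ : Perm n) → LowerBoundsSplit T T₁ T₂ →
      IsMeet (u ∷ T₁) y₁ → IsMeet (v ∷ T₂) y₂ → IsMeet (u ⊕ v ∷ T) (y₁ ⊕ y₂)
    isMeet-⊕ {T} {T₁} {T₂} y₁ y₂ split (y₁-tam , y₁≤u ∷ y₁≤T₁ , greatest₁) (y₂-tam , y₂≤v ∷ y₂≤T₂ , greatest₂) =
      tam-⊕ y₁ y₂ y₁-tam y₂-tam ,
      ≤W-⊕ y₁ y₂ u v y₁≤u y₂≤v ∷ from (lowerBounds split y₁ y₂ y₁≤u y₂≤v) (y₁≤T₁ , y₂≤T₂) ,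
      greatest
      where
      greatest : ∀ z → Tam z → All (z ≤W_) (u ⊕ v ∷ T) → z ≤W (y₁ ⊕ y₂)
      greatest z z-tam (z≤u⊕v ∷ z≤T) with below-⊕ u v z (proj₁ z-tam) z≤u⊕v
      ... | z₁ , z₂ , refl = ≤W-⊕ z₁ z₂ y₁ y₂
        (greatest₁ z₁ (tam-⊕ˡ⁻ z₁ z₂ z-tam) (z₁≤u ∷ proj₁ z≤Tᵢ))
        (greatest₂ z₂ (tam-⊕ʳ⁻ z₁ z₂ z-tam) (z₂≤v ∷ proj₂ z≤Tᵢ))
        where
        z₁≤u : z₁ ≤W u
        z₁≤u = ≤W-⊕ˡ⁻ z₁ z₂ u v z≤u⊕v
        z₂≤v : z₂ ≤W v
        z₂≤v = ≤W-⊕ʳ⁻ z₁ z₂ u v z≤u⊕v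
        z≤Tᵢ : All (z₁ ≤W_) T₁ × All (z₂ ≤W_) T₂
        z≤Tᵢ = to (lowerBounds split z₁ z₂ z₁≤u z₂≤v) z≤T

    isMeet-⊕⁻ : ∀ {T T₁ T₂} (y₁ : Perm m) (y₂ : Perm n) → LowerBoundsSplit T T₁ T₂ →
      IsMeet (u ⊕ v ∷ T) (y₁ ⊕ y₂) → IsMeet (u ∷ T₁) y₁ × IsMeet (v ∷ T₂) y₂
    isMeet-⊕⁻ {T} {T₁} {T₂} y₁ y₂ split (y-tam , y≤u⊕v ∷ y≤T , greatest) =
      (tam-⊕ˡ⁻ y₁ y₂ y-tam , y₁≤u ∷ proj₁ y≤Tᵢ , greatest₁) ,
      (tam-⊕ʳ⁻ y₁ y₂ y-tam , y₂≤v ∷ proj₂ y≤Tᵢ , greatest₂)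
      where
      y₁≤u : y₁ ≤W u
      y₁≤u = ≤W-⊕ˡ⁻ y₁ y₂ u v y≤u⊕v
      y₂≤v : y₂ ≤W v
      y₂≤v = ≤W-⊕ʳ⁻ y₁ y₂ u v y≤u⊕v
      y≤Tᵢ : All (y₁ ≤W_) T₁ × All (y₂ ≤W_) T₂
      y≤Tᵢ = to (lowerBounds split y₁ y₂ y₁≤u y₂≤v) y≤T
      greatest₁ : ∀ z₁ → Tam z₁ → All (z₁ ≤W_) (u ∷ T₁) → z₁ ≤W y₁
      greatest₁ z₁ z₁-tam (z₁≤u ∷ z₁≤T₁) = ≤W-⊕ˡ⁻ z₁ y₂ y₁ y₂ (greatest (z₁ ⊕ y₂)
        (tam-⊕ z₁ y₂ z₁-tam (tam-⊕ʳ⁻ y₁ y₂ y-tam))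
        (≤W-⊕ z₁ y₂ u v z₁≤u y₂≤v ∷ from (lowerBounds split z₁ y₂ z₁≤u y₂≤v) (z₁≤T₁ , proj₂ y≤Tᵢ)))
      greatest₂ : ∀ z₂ → Tam z₂ → All (z₂ ≤W_) (v ∷ T₂) → z₂ ≤W y₂
      greatest₂ z₂ z₂-tam (z₂≤v ∷ z₂≤T₂) = ≤W-⊕ʳ⁻ y₁ z₂ y₁ y₂ (greatest (y₁ ⊕ z₂)
        (tam-⊕ y₁ z₂ (tam-⊕ˡ⁻ y₁ y₂ y-tam) z₂-tam)
        (≤W-⊕ y₁ z₂ u v y₁≤u z₂≤v ∷ from (lowerBounds split y₁ z₂ y₁≤u z₂≤v) (proj₁ y≤Tᵢ , z₂≤T₂)))

    ung-⊕ : Tam u → Tam v → ∀ u′ v′ → Ung u u′ → Ung v v′ → Ung (u ⊕ v) (u′ ⊕ v′)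
    ung-⊕ u-tam v-tam u′ v′ (T₁ , covers₁ , meet₁) (T₂ , covers₂ , meet₂) =
      List.map (_⊕ v) T₁ ++ List.map (u ⊕_) T₂ ,
      ++⁺ (map⁺ (All.map (covers-⊕ˡ v-tam) covers₁)) (map⁺ (All.map (covers-⊕ʳ u-tam) covers₂)) ,
      isMeet-⊕ u′ v′ (lowerBoundsSplit-++ T₁ T₂) meet₁ meet₂

    ung-⊕⁻ : Tam u → Tam v → ∀ y → Ung (u ⊕ v) y →
      ∃ λ u′ → ∃ λ v′ → y ≡ u′ ⊕ v′ × Ung u u′ × Ung v v′
    ung-⊕⁻ u-tam v-tam y (T , covers , meet@(y-tam , y≤u⊕v ∷ _ , _))
      with below-⊕ u v y (proj₁ y-tam) y≤u⊕v | lowerBoundsSplit-covers u-tam v-tam covers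
    ... | y₁ , y₂ , refl | T₁ , T₂ , covers₁ , covers₂ , split =
      y₁ , y₂ , refl ,
      (T₁ , covers₁ , proj₁ (isMeet-⊕⁻ y₁ y₂ split meet)) ,
      (T₂ , covers₂ , proj₂ (isMeet-⊕⁻ y₁ y₂ split meet))

  -- The Ungar game on a direct sum

  mutual
    eetaWin-⊕ : (u : Perm m) (v : Perm n) → Tam u → Tam v → EetaWin u → EetaWin v → EetaWin (u ⊕ v)
    eetaWin-⊕ u v u-tam v-tam u-eeta v-eeta = eeta atnissAfter
      where
      atnissAfter : ∀ y → Ung (u ⊕ v) y → y ≢ u ⊕ v → AtnissWin y
      atnissAfter y move y≢u⊕v with ung-⊕⁻ u v u-tam v-tam y move
      ... | u′ , v′ , refl , move₁ , move₂ = atnissWin-after-⊕ u v u-tam v-tam u-eeta v-eeta u′ v′ move₁ move₂ y≢u⊕v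

    atnissWin-after-⊕ : (u : Perm m) (v : Perm n) → Tam u → Tam v → EetaWin u → EetaWin v →
      ∀ u′ v′ → Ung u u′ → Ung v v′ → u′ ⊕ v′ ≢ u ⊕ v → AtnissWin (u′ ⊕ v′)
    atnissWin-after-⊕ u v u-tam v-tam (eeta u-after) (eeta v-after) u′ v′ move₁ move₂ moved with u′ ≟ₚ u | v′ ≟ₚ v
    ... | yes refl | yes refl = ⊥-elim (moved refl)
    ... | yes refl | no v′≢v  = atnissWin-⊕ʳ u v′ u-tam (ung-tam v′ move₂) (eeta u-after) (v-after v′ move₂ v′≢v)
    ... | no u′≢u  | yes refl = atnissWin-⊕ˡ u′ v (ung-tam u′ move₁) v-tam (u-after u′ move₁ u′≢u) (eeta v-after)
    ... | no u′≢u  | no v′≢v  = atnissWin-⊕ u′ v′ (ung-tam u′ move₁) (ung-tam v′ move₂)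
                                  (u-after u′ move₁ u′≢u) (v-after v′ move₂ v′≢v)

    atnissWin-⊕ˡ : (u : Perm m) (v : Perm n) → Tam u → Tam v → AtnissWin u → EetaWin v → AtnissWin (u ⊕ v)
    atnissWin-⊕ˡ u v u-tam v-tam (atniss z move z≢u z-eeta) v-eeta =
      atniss (z ⊕ v) (ung-⊕ u v u-tam v-tam z v move (ung-refl v v-tam)) (z≢u ∘ ⊕-injectiveˡ)
        (eetaWin-⊕ z v (ung-tam z move) v-tam z-eeta v-eeta)

    atnissWin-⊕ʳ : (u : Perm m) (v : Perm n) → Tam u → Tam v → EetaWin u → AtnissWin v → AtnissWin (u ⊕ v)
    atnissWin-⊕ʳ u v u-tam v-tam u-eeta (atniss z move z≢v z-eeta) =
      atniss (u ⊕ z) (ung-⊕ u v u-tam v-tam u z (ung-refl u u-tam) move) (z≢v ∘ ⊕-injectiveʳ)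
        (eetaWin-⊕ u z u-tam (ung-tam z move) u-eeta z-eeta)

    atnissWin-⊕ : (u : Perm m) (v : Perm n) → Tam u → Tam v → AtnissWin u → AtnissWin v → AtnissWin (u ⊕ v)
    atnissWin-⊕ u v u-tam v-tam (atniss z₁ move₁ z₁≢u z₁-eeta) (atniss z₂ move₂ _ z₂-eeta) =
      atniss (z₁ ⊕ z₂) (ung-⊕ u v u-tam v-tam z₁ z₂ move₁ move₂) (z₁≢u ∘ ⊕-injectiveˡ)
        (eetaWin-⊕ z₁ z₂ (ung-tam z₁ move₁) (ung-tam z₂ move₂) z₁-eeta z₂-eeta)

  mutual
    eetaWin-⊕⁻ : (u : Perm m) (v : Perm n) → Tam u → Tam v → EetaWin (u ⊕ v) → EetaWin u × EetaWin v
    eetaWin-⊕⁻ u v u-tam v-tam u⊕v-eeta@(eeta atnissAfter) =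
      eeta (λ u′ move u′≢u → atnissWin-⊕ˡ⁻ u v u-tam v-tam u⊕v-eeta u′ move u′≢u
             (atnissAfter (u′ ⊕ v) (ung-⊕ u v u-tam v-tam u′ v move (ung-refl v v-tam)) (u′≢u ∘ ⊕-injectiveˡ))) ,
      eeta (λ v′ move v′≢v → atnissWin-⊕ʳ⁻ u v u-tam v-tam u⊕v-eeta v′ move v′≢v
             (atnissAfter (u ⊕ v′) (ung-⊕ u v u-tam v-tam u v′ (ung-refl u u-tam) move) (v′≢v ∘ ⊕-injectiveʳ)))

    atnissWin-⊕ˡ⁻ : (u : Perm m) (v : Perm n) → Tam u → Tam v → EetaWin (u ⊕ v) →
      ∀ u′ → Ung u u′ → u′ ≢ u → AtnissWin (u′ ⊕ v) → AtnissWin u′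
    atnissWin-⊕ˡ⁻ u v u-tam v-tam (eeta atnissAfter) u′ move u′≢u (atniss y reply _ y-eeta)
      with ung-⊕⁻ u′ v (ung-tam u′ move) v-tam y reply
    ... | u″ , v″ , refl , reply₁ , reply₂ with u″ ≟ₚ u′
    ...   | no u″≢u′ = atniss u″ reply₁ u″≢u′
                         (proj₁ (eetaWin-⊕⁻ u″ v″ (ung-tam u″ reply₁) (ung-tam v″ reply₂) y-eeta))
    ...   | yes refl = ⊥-elim (eetaWin⇒¬atnissWin y-eeta
                         (atnissAfter (u″ ⊕ v″) (ung-⊕ u v u-tam v-tam u″ v″ move reply₂) (u′≢u ∘ ⊕-injectiveˡ)))

    atnissWin-⊕ʳ⁻ : (u : Perm m) (v : Perm n) → Tam u → Tam v → EetaWin (u ⊕ v) →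
      ∀ v′ → Ung v v′ → v′ ≢ v → AtnissWin (u ⊕ v′) → AtnissWin v′
    atnissWin-⊕ʳ⁻ u v u-tam v-tam (eeta atnissAfter) v′ move v′≢v (atniss y reply _ y-eeta)
      with ung-⊕⁻ u v′ u-tam (ung-tam v′ move) y reply
    ... | u″ , v″ , refl , reply₁ , reply₂ with v″ ≟ₚ v′
    ...   | no v″≢v′ = atniss v″ reply₂ v″≢v′
                         (proj₂ (eetaWin-⊕⁻ u″ v″ (ung-tam u″ reply₁) (ung-tam v″ reply₂) y-eeta))
    ...   | yes refl = ⊥-elim (eetaWin⇒¬atnissWin y-eeta
                         (atnissAfter (u″ ⊕ v″) (ung-⊕ u v u-tam v-tam u″ v″ reply₁ move) (v′≢v ∘ ⊕-injectiveʳ)))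

eetaWin-[] : EetaWin {0} Vec.[]
eetaWin-[] = eeta λ { Vec.[] _ []≢[] → ⊥-elim ([]≢[] refl) }

proposition5p1 : (cs : List SizedPerm) → All IsComponent cs →
    Tam (bigSum cs) →
    (EetaWin (bigSum cs) ⇔ All EetaWinSized cs)
proposition5p1 [] _ _ = mk⇔ (λ _ → []) (λ _ → eetaWin-[])
proposition5p1 ((m , u) ∷ cs) (_ ∷ components) sum-tam = mk⇔
  (λ sum-eeta → let u-eeta , rest-eeta = eetaWin-⊕⁻ u rest u-tam rest-tam sum-eeta
                in u-eeta ∷ to rest-equiv rest-eeta)
  (λ { (u-eeta ∷ cs-eeta) → eetaWin-⊕ u rest u-tam rest-tam u-eeta (from rest-equiv cs-eeta) })
  where
  rest : Perm (totalSize cs)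
  rest = bigSum cs
  u-tam : Tam u
  u-tam = tam-⊕ˡ⁻ u rest sum-tam
  rest-tam : Tam rest
  rest-tam = tam-⊕ʳ⁻ u rest sum-tam
  rest-equiv : EetaWin rest ⇔ All EetaWinSized cs
  rest-equiv = proposition5p1 cs components rest-tam
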